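{- For $n\geq 1$, let $P_n$ be the set of all sequences of positive integers $s_1,s_2,\ldots,s_n$ such that $s_1=1$ and $s_j\leq |\{i : s_i=1,\ i<j\}|+1$ for all $j=2,3,\ldots,n$. Then $|P_n|=B_n=\sum_{k=1}^n S(n,k)$, the $n$-th Bell number, and for each $k$ the number of sequences in $P_n$ containing exactly $k$ entries equal to $1$ is $S(n,k)$.
   Context: $S(n,k)$ denotes the Stirling number of the second kind (number of partitions of an $n$-element set into $k$ nonempty blocks). -}

module Defs where

open import Data.Nat using (ℕ; zero; suc; _+_; _*_; _≤_)
open import Data.Fin using (Fin; toℕ)
open import Data.Vec using (Vec; lookup; toList)
open import Data.List using (List; []; _∷_; length; take)
open import Data.List.Membership.Propositional using (_∈_)
open import Data.List.Relation.Unary.Unique.Propositional using (Unique)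
open import Data.Product using (_×_; Σ)
open import Function.Bundles using (_⇔_)
open import Relation.Binary.PropositionalEquality using (_≡_)

S : ℕ → ℕ → ℕ
S zero    zero    = 1
S zero    (suc k) = 0
S (suc n) zero    = 0
S (suc n) (suc k) = suc k * S n (suc k) + S n k

sumS : ℕ → ℕ → ℕ
sumS n zero    = 0
sumS n (suc m) = sumS n m + S n (suc m)

Bell : ℕ → ℕ
Bell n = sumS n n

onesL : List ℕ → ℕ
onesL []             = 0
onesL (suc zero ∷ v) = suc (onesL v)
onesL (_ ∷ v)        = onesL v

ones : ∀ {m} → Vec ℕ m → ℕ
ones v = onesL (toList v)

-- Membership in P_n (0-based positions: position i corresponds to s_{i+1}).
-- s : Vec ℕ n, all entries positive, s_1 = 1, and for positions i ≥ 1
-- s_{i+1} ≤ |{ l < i : s_{l+1} = 1 }| + 1 (number of ones among the first i entries).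
record InP {n : ℕ} (s : Vec ℕ n) : Set where
  field
    positive : (i : Fin n) → 1 ≤ lookup s i
    first    : (i : Fin n) → toℕ i ≡ 0 → lookup s i ≡ 1
    bound    : (i : Fin n) → 1 ≤ toℕ i →
               lookup s i ≤ onesL (take (toℕ i) (toList s)) + 1

-- "the finite set of all s satisfying P has exactly c elements":
-- there is a duplicate-free list enumerating exactly those s, of length c.
HasCard : ∀ {A : Set} → (A → Set) → ℕ → Set
HasCard {A} P c = Σ (List A) λ L → Unique L × ((s : A) → (s ∈ L) ⇔ P s) × (length L ≡ c)

{-# OPTIONS --safe #-}
-- Read the condition defining P_n from left to right: after a prefix with r ones, the next entry
-- is either a 1, which raises r, or one of the r values 2, …, r + 1.  Hence the number T(r, m, j)
-- of admissible continuations of length m with j further ones satisfies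
-- T(r, m+1, j+1) = T(r+1, m, j) + r T(r, m, j+1), and induction on m turns this into
-- T(r, m+1, j+1) = T(r, m, j) + (r + j + 1) T(r, m, j+1), which at r = 0 is the recurrence of S(n, k).
module Submission where

open import Defs
open import Data.Empty using (⊥; ⊥-elim)
open import Data.Fin using (Fin; toℕ) renaming (zero to fzero; suc to fsuc)
open import Data.List using (List; []; _∷_; _++_; map; length; take; applyUpTo; cartesianProductWith)
open import Data.List.Membership.Propositional using (_∈_)
open import Data.List.Membership.Propositional.Properties
  using (++-∈⇔; ∈-cartesianProductWith⁺; ∈-cartesianProductWith⁻; ∈-applyUpTo⁺; ∈-applyUpTo⁻)
open import Data.List.Properties using (length-++; length-map; length-applyUpTo)
open import Data.List.Relation.Unary.All using ([])
open import Data.List.Relation.Unary.AllPairs using ([]; _∷_)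
open import Data.List.Relation.Unary.Any using (here; there)
import Data.List.Relation.Unary.Unique.Propositional.Properties as Unique
open import Data.Nat using (ℕ; zero; suc; _+_; _*_; _≤_; z≤n; s≤s; s≤s⁻¹)
open import Data.Nat.Properties
  using (+-comm; +-assoc; +-identityʳ; *-identityˡ; *-zeroʳ; +-cancelˡ-≡; ≤-reflexive; ≤-trans;
         ≤-antisym; <⇒≢; <⇒≱; suc-injective; 1+n≰n; m≤n⇒m≤1+n; m≤n⇒m<n∨m≡n)
open import Data.Nat.Tactic.RingSolver using (solve-∀)
open import Data.Product using (_×_; _,_; proj₁; proj₂)
open import Data.Product.Function.NonDependent.Propositional using (_×-⇔_)
open import Data.Sum using (_⊎_; inj₁; inj₂)
open import Data.Sum.Function.Propositional using (_⊎-⇔_)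
open import Data.Unit using (⊤; tt)
open import Data.Vec using (Vec; []; _∷_; head; tail; lookup; toList)
open import Data.Vec.Properties using (∷-injective)
open import Function using (_∘_)
open import Function.Bundles using (_⇔_; mk⇔; Equivalence)
import Function.Properties.Equivalence as ⇔
open import Relation.Binary.PropositionalEquality as ≡ using (_≡_; refl; sym; cong; cong₂; subst)
open ≡.≡-Reasoning

private variable
  A B C : Set
  P Q : A → Set
  c d m : ℕ

length-cartesianProductWith : (f : A → B → C) (xs : List A) (ys : List B) →
  length (cartesianProductWith f xs ys) ≡ length xs * length ys
length-cartesianProductWith f []       ys = refl
length-cartesianProductWith f (x ∷ xs) ys = begin
  length (map (f x) ys ++ cartesianProductWith f xs ys)
    ≡⟨ length-++ (map (f x) ys) ⟩
  length (map (f x) ys) + length (cartesianProductWith f xs ys)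
    ≡⟨ cong₂ _+_ (length-map (f x) ys) (length-cartesianProductWith f xs ys) ⟩
  length ys + length xs * length ys ∎

HasCard-cong : (∀ a → P a ⇔ Q a) → HasCard P c → HasCard Q c
HasCard-cong P⇔Q (L , L! , ∈L⇔P , |L|) = L , L! , (λ a → ⇔.trans (∈L⇔P a) (P⇔Q a)) , |L|

HasCard-∅ : (∀ a → P a → ⊥) → HasCard P 0
HasCard-∅ ¬P = [] , [] , (λ a → mk⇔ (λ ()) (⊥-elim ∘ ¬P a)) , refl

HasCard-≡ : (a : A) → HasCard (_≡ a) 1
HasCard-≡ a = a ∷ [] , [] ∷ [] , (λ x → mk⇔ (λ { (here x≡a) → x≡a ; (there ()) }) here) , refl

HasCard-⊎ : (∀ {a} → P a → Q a → ⊥) → HasCard P c → HasCard Q d →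
            HasCard (λ a → P a ⊎ Q a) (c + d)
HasCard-⊎ P∩Q=∅ (L , L! , ∈L⇔P , |L|) (M , M! , ∈M⇔Q , |M|) =
  L ++ M ,
  Unique.++⁺ L! M! (λ (a∈L , a∈M) → P∩Q=∅ (Equivalence.to (∈L⇔P _) a∈L) (Equivalence.to (∈M⇔Q _) a∈M)) ,
  (λ a → ⇔.trans ++-∈⇔ (∈L⇔P a ⊎-⇔ ∈M⇔Q a)) ,
  ≡.trans (length-++ L) (cong₂ _+_ |L| |M|)

HasCard-∷ : HasCard P c → HasCard Q d →
            HasCard {Vec A (suc m)} (λ v → P (head v) × Q (tail v)) (c * d)
HasCard-∷ {P = P} {Q = Q} (L , L! , ∈L⇔P , |L|) (M , M! , ∈M⇔Q , |M|) =
  cartesianProductWith _∷_ L M ,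
  Unique.cartesianProductWith⁺ _∷_ ∷-injective L! M! ,
  ∈⇔ ,
  ≡.trans (length-cartesianProductWith _∷_ L M) (cong₂ _*_ |L| |M|)
  where
  ∈⇔ : ∀ v → v ∈ cartesianProductWith _∷_ L M ⇔ (P (head v) × Q (tail v))
  ∈⇔ (x ∷ w) = mk⇔ to (λ (px , qw) → ∈-cartesianProductWith⁺ _∷_ (Equivalence.from (∈L⇔P x) px)
                                                                   (Equivalence.from (∈M⇔Q w) qw))
    where
    to : x ∷ w ∈ cartesianProductWith _∷_ L M → P x × Q w
    to x∷w∈ with _ , _ , x∈L , w∈M , refl ← ∈-cartesianProductWith⁻ _∷_ L M x∷w∈ =
      Equivalence.to (∈L⇔P x) x∈L , Equivalence.to (∈M⇔Q w) w∈M

sum1to : (ℕ → ℕ) → ℕ → ℕ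
sum1to f zero    = 0
sum1to f (suc k) = sum1to f k + f (suc k)

HasCard-1≤∧≤ : (f : A → ℕ) {count : ℕ → ℕ} → (∀ j → HasCard (λ a → P a × f a ≡ j) (count j)) →
               ∀ k → HasCard (λ a → P a × 1 ≤ f a × f a ≤ k) (sum1to count k)
HasCard-1≤∧≤ f fibre zero    = HasCard-∅ (λ a (_ , 1≤fa , fa≤0) → <⇒≱ 1≤fa fa≤0)
HasCard-1≤∧≤ {P = P} f fibre (suc k) =
  HasCard-cong split (HasCard-⊎ disjoint (HasCard-1≤∧≤ f fibre k) (fibre (suc k)))
  where
  disjoint : ∀ {a} → P a × 1 ≤ f a × f a ≤ k → P a × f a ≡ suc k → ⊥
  disjoint (_ , _ , fa≤k) (_ , fa≡1+k) = 1+n≰n (subst (_≤ k) fa≡1+k fa≤k)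
  split : ∀ a → ((P a × 1 ≤ f a × f a ≤ k) ⊎ (P a × f a ≡ suc k)) ⇔ (P a × 1 ≤ f a × f a ≤ suc k)
  split a = mk⇔ to from
    where
    to : (P a × 1 ≤ f a × f a ≤ k) ⊎ (P a × f a ≡ suc k) → P a × 1 ≤ f a × f a ≤ suc k
    to (inj₁ (pa , 1≤fa , fa≤k)) = pa , 1≤fa , m≤n⇒m≤1+n fa≤k
    to (inj₂ (pa , fa≡1+k))      = pa , subst (1 ≤_) (sym fa≡1+k) (s≤s z≤n) , ≤-reflexive fa≡1+k
    from : P a × 1 ≤ f a × f a ≤ suc k → (P a × 1 ≤ f a × f a ≤ k) ⊎ (P a × f a ≡ suc k)
    from (pa , 1≤fa , fa≤1+k) with m≤n⇒m<n∨m≡n fa≤1+k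
    ... | inj₁ fa<1+k = inj₁ (pa , 1≤fa , s≤s⁻¹ fa<1+k)
    ... | inj₂ fa≡1+k = inj₂ (pa , fa≡1+k)

sumS≡sum1to : ∀ n k → sumS n k ≡ sum1to (S n) k
sumS≡sum1to n zero    = refl
sumS≡sum1to n (suc k) = cong (_+ S n (suc k)) (sumS≡sum1to n k)

-- rStirling r m j is the r-Stirling number S_r(m + r, j + r).
rStirling : ℕ → ℕ → ℕ → ℕ
rStirling r zero    zero    = 1
rStirling r zero    (suc j) = 0
rStirling r (suc m) zero    = r * rStirling r m zero
rStirling r (suc m) (suc j) = rStirling (suc r) m j + r * rStirling r m (suc j)

rStirling-suc : ∀ r m j →
  rStirling r (suc m) (suc j) ≡ rStirling r m j + (r + suc j) * rStirling r m (suc j)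
rStirling-suc r zero zero    = cong suc (≡.trans (*-zeroʳ r) (sym (*-zeroʳ (r + 1))))
rStirling-suc r zero (suc j) = ≡.trans (*-zeroʳ r) (sym (*-zeroʳ (r + suc (suc j))))
rStirling-suc r (suc m) zero = begin
  suc r * x + r * rStirling r (suc m) 1   ≡⟨ cong (λ t → suc r * x + r * t) (rStirling-suc r m zero) ⟩
  suc r * x + r * (y + (r + 1) * z)      ≡⟨ regroup r x y z ⟩
  r * y + (r + 1) * (x + r * z)          ∎
  where
  x y z : ℕ
  x = rStirling (suc r) m zero
  y = rStirling r m zero
  z = rStirling r m 1
  regroup : ∀ r x y z → suc r * x + r * (y + (r + 1) * z) ≡ r * y + (r + 1) * (x + r * z)
  regroup = solve-∀
rStirling-suc r (suc m) (suc j) = begin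
  rStirling (suc r) (suc m) (suc j) + r * rStirling r (suc m) (suc (suc j))
    ≡⟨ cong₂ _+_ (rStirling-suc (suc r) m j) (cong (r *_) (rStirling-suc r m (suc j))) ⟩
  (x + (suc r + suc j) * y) + r * (z + (r + suc (suc j)) * w)
    ≡⟨ regroup r j x y z w ⟩
  (x + r * z) + (r + suc (suc j)) * (y + r * w) ∎
  where
  x y z w : ℕ
  x = rStirling (suc r) m j
  y = rStirling (suc r) m (suc j)
  z = rStirling r m (suc j)
  w = rStirling r m (suc (suc j))
  regroup : ∀ r j x y z w → (x + (suc r + suc j) * y) + r * (z + (r + suc (suc j)) * w)
                          ≡ (x + r * z) + (r + suc (suc j)) * (y + r * w)
  regroup = solve-∀

rStirling₀≡S : ∀ n k → rStirling 0 n k ≡ S n k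
rStirling₀≡S zero    zero    = refl
rStirling₀≡S zero    (suc k) = refl
rStirling₀≡S (suc n) zero    = refl
rStirling₀≡S (suc n) (suc k) = begin
  rStirling 0 (suc n) (suc k)
    ≡⟨ rStirling-suc 0 n k ⟩
  rStirling 0 n k + suc k * rStirling 0 n (suc k)
    ≡⟨ cong₂ (λ s t → s + suc k * t) (rStirling₀≡S n k) (rStirling₀≡S n (suc k)) ⟩
  S n k + suc k * S n (suc k)
    ≡⟨ +-comm (S n k) _ ⟩
  S (suc n) (suc k) ∎

isOne : ℕ → ℕ
isOne 1 = 1
isOne _ = 0

onesL-∷ : ∀ x l → onesL (x ∷ l) ≡ isOne x + onesL l
onesL-∷ zero          l = refl
onesL-∷ (suc zero)    l = refl
onesL-∷ (suc (suc _)) l = refl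

ones≤length : (s : Vec ℕ m) → ones s ≤ m
ones≤length []                = z≤n
ones≤length (zero ∷ s)        = m≤n⇒m≤1+n (ones≤length s)
ones≤length (suc zero ∷ s)    = s≤s (ones≤length s)
ones≤length (suc (suc _) ∷ s) = m≤n⇒m≤1+n (ones≤length s)

-- Admissible r s: s is an admissible continuation of a prefix containing r ones.
Admissible : ℕ → Vec ℕ m → Set
Admissible r []      = ⊤
Admissible r (x ∷ s) = (1 ≤ x × x ≤ suc r) × Admissible (isOne x + r) s

NonOne : ℕ → ℕ → Set
NonOne r x = 2 ≤ x × x ≤ suc r

HasCard-NonOne : ∀ r → HasCard (NonOne r) r
HasCard-NonOne r =
  applyUpTo (2 +_) r ,
  Unique.applyUpTo⁺₁ (2 +_) r (λ i<j _ → <⇒≢ i<j ∘ +-cancelˡ-≡ 2 _ _) ,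
  (λ x → mk⇔ to from) ,
  length-applyUpTo (2 +_) r
  where
  to : ∀ {x} → x ∈ applyUpTo (2 +_) r → NonOne r x
  to x∈ with _ , i<r , refl ← ∈-applyUpTo⁻ (2 +_) x∈ = s≤s (s≤s z≤n) , s≤s i<r
  from : ∀ {x} → NonOne r x → x ∈ applyUpTo (2 +_) r
  from (s≤s (s≤s z≤n) , s≤s i<r) = ∈-applyUpTo⁺ (2 +_) i<r

∷-admissible-ones≡0 : ∀ r (s : Vec ℕ (suc m)) →
  (NonOne r (head s) × Admissible r (tail s) × ones (tail s) ≡ 0) ⇔ (Admissible r s × ones s ≡ 0)
∷-admissible-ones≡0 r (x ∷ t) = mk⇔ (to x) (from x)
  where
  Tail : Set
  Tail = Admissible r t × ones t ≡ 0
  to : ∀ x → NonOne r x × Tail → Admissible r (x ∷ t) × ones (x ∷ t) ≡ 0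
  to _ ((s≤s (s≤s z≤n) , x≤1+r) , adm , ones≡0) = ((s≤s z≤n , x≤1+r) , adm) , ones≡0
  from : ∀ x → Admissible r (x ∷ t) × ones (x ∷ t) ≡ 0 → NonOne r x × Tail
  from zero          (((() , _) , _) , _)
  from (suc zero)    (_ , ())
  from (suc (suc _)) (((_ , x≤1+r) , adm) , ones≡0) = (s≤s (s≤s z≤n) , x≤1+r) , adm , ones≡0

∷-admissible-ones≡suc : ∀ r j (s : Vec ℕ (suc m)) →
  ((head s ≡ 1 × Admissible (suc r) (tail s) × ones (tail s) ≡ j) ⊎
   (NonOne r (head s) × Admissible r (tail s) × ones (tail s) ≡ suc j))
  ⇔ (Admissible r s × ones s ≡ suc j)
∷-admissible-ones≡suc r j (x ∷ t) = mk⇔ (to x) (from x)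
  where
  Tail : ℕ → ℕ → Set
  Tail r′ j′ = Admissible r′ t × ones t ≡ j′
  to : ∀ x → (x ≡ 1 × Tail (suc r) j) ⊎ (NonOne r x × Tail r (suc j)) →
       Admissible r (x ∷ t) × ones (x ∷ t) ≡ suc j
  to _ (inj₁ (refl , adm , ones≡j)) = ((s≤s z≤n , s≤s z≤n) , adm) , cong suc ones≡j
  to _ (inj₂ ((s≤s (s≤s z≤n) , x≤1+r) , adm , ones≡1+j)) = ((s≤s z≤n , x≤1+r) , adm) , ones≡1+j
  from : ∀ x → Admissible r (x ∷ t) × ones (x ∷ t) ≡ suc j →
         (x ≡ 1 × Tail (suc r) j) ⊎ (NonOne r x × Tail r (suc j))
  from zero          (((() , _) , _) , _)
  from (suc zero)    ((_ , adm) , ones≡1+j) = inj₁ (refl , adm , suc-injective ones≡1+j)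
  from (suc (suc _)) (((_ , x≤1+r) , adm) , ones≡1+j) = inj₂ ((s≤s (s≤s z≤n) , x≤1+r) , adm , ones≡1+j)

HasCard-admissible : ∀ r m j → HasCard {Vec ℕ m} (λ s → Admissible r s × ones s ≡ j) (rStirling r m j)
HasCard-admissible r zero zero =
  HasCard-cong (λ { [] → mk⇔ (λ _ → tt , refl) (λ _ → refl) }) (HasCard-≡ [])
HasCard-admissible r zero (suc j) = HasCard-∅ (λ { [] (_ , ()) })
HasCard-admissible r (suc m) zero =
  HasCard-cong (∷-admissible-ones≡0 r) (HasCard-∷ (HasCard-NonOne r) (HasCard-admissible r m zero))
HasCard-admissible r (suc m) (suc j) =
  HasCard-cong (∷-admissible-ones≡suc r j)
    (HasCard-⊎ (λ (x≡1 , _) ((2≤x , _) , _) → <⇒≱ 2≤x (≤-reflexive x≡1))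
      headIsOne
      (HasCard-∷ (HasCard-NonOne r) (HasCard-admissible r m (suc j))))
  where
  headIsOne : HasCard (λ (s : Vec ℕ (suc m)) → head s ≡ 1 × Admissible (suc r) (tail s) × ones (tail s) ≡ j)
                      (rStirling (suc r) m j)
  headIsOne = subst (HasCard _) (*-identityˡ _) (HasCard-∷ (HasCard-≡ 1) (HasCard-admissible (suc r) m j))

-- The condition of InP, with r extra ones counted before the first entry.
Bounded : ℕ → Vec ℕ m → Set
Bounded {m} r s = (i : Fin m) → 1 ≤ lookup s i × lookup s i ≤ suc (r + onesL (take (toℕ i) (toList s)))

isOne+r+onesL : ∀ r x l → isOne x + r + onesL l ≡ r + onesL (x ∷ l)
isOne+r+onesL r x l = begin
  isOne x + r + onesL l    ≡⟨ cong (_+ onesL l) (+-comm (isOne x) r) ⟩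
  r + isOne x + onesL l    ≡⟨ +-assoc r (isOne x) (onesL l) ⟩
  r + (isOne x + onesL l)  ≡⟨ cong (r +_) (onesL-∷ x l) ⟨
  r + onesL (x ∷ l)        ∎

Admissible⇒Bounded : ∀ r (s : Vec ℕ m) → Admissible r s → Bounded r s
Admissible⇒Bounded r (x ∷ s) ((1≤x , x≤1+r) , _) fzero =
  1≤x , ≤-trans x≤1+r (≤-reflexive (cong suc (sym (+-identityʳ r))))
Admissible⇒Bounded r (x ∷ s) (_ , adm) (fsuc i)
  with 1≤sᵢ , sᵢ≤ ← Admissible⇒Bounded (isOne x + r) s adm i =
  1≤sᵢ , ≤-trans sᵢ≤ (≤-reflexive (cong suc (isOne+r+onesL r x (take (toℕ i) (toList s)))))

Bounded⇒Admissible : ∀ r (s : Vec ℕ m) → Bounded r s → Admissible r s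
Bounded⇒Admissible r []      _   = tt
Bounded⇒Admissible r (x ∷ s) bnd =
  (proj₁ (bnd fzero) , ≤-trans (proj₂ (bnd fzero)) (≤-reflexive (cong suc (+-identityʳ r)))) ,
  Bounded⇒Admissible (isOne x + r) s λ i →
    proj₁ (bnd (fsuc i)) ,
    ≤-trans (proj₂ (bnd (fsuc i))) (≤-reflexive (cong suc (sym (isOne+r+onesL r x (take (toℕ i) (toList s))))))

InP⇔Bounded₀ : (s : Vec ℕ m) → InP s ⇔ Bounded 0 s
InP⇔Bounded₀ s = mk⇔ to from
  where
  to : InP s → Bounded 0 s
  to p fzero    = positive fzero , ≤-reflexive (first fzero refl) where open InP p
  to p (fsuc i) = positive (fsuc i) , ≤-trans (bound (fsuc i) (s≤s z≤n)) (≤-reflexive (+-comm _ 1))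
    where open InP p
  from : Bounded 0 s → InP s
  from bnd = record
    { positive = proj₁ ∘ bnd
    ; first    = λ { fzero _ → ≤-antisym (proj₂ (bnd fzero)) (proj₁ (bnd fzero)) }
    ; bound    = λ i _ → ≤-trans (proj₂ (bnd i)) (≤-reflexive (+-comm 1 _))
    }

InP⇔Admissible₀ : (s : Vec ℕ m) → InP s ⇔ Admissible 0 s
InP⇔Admissible₀ s = ⇔.trans (InP⇔Bounded₀ s) (mk⇔ (Bounded⇒Admissible 0 s) (Admissible⇒Bounded 0 s))

InP⇒1≤ones : (s : Vec ℕ (suc m)) → InP s → 1 ≤ ones s
InP⇒1≤ones (x ∷ s) p with refl ← InP.first p fzero refl = s≤s z≤n

HasCard-InP-ones : ∀ n k → HasCard {Vec ℕ n} (λ s → InP s × ones s ≡ k) (S n k)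
HasCard-InP-ones n k =
  subst (HasCard _) (rStirling₀≡S n k)
    (HasCard-cong (λ s → ⇔.sym (InP⇔Admissible₀ s) ×-⇔ ⇔.refl) (HasCard-admissible 0 n k))

mainTheorem2 : (n : ℕ) → 1 ≤ n →
    HasCard {Vec ℕ n} InP (Bell n) ×
    ((k : ℕ) → HasCard {Vec ℕ n} (λ s → InP s × ones s ≡ k) (S n k))
mainTheorem2 n@(suc _) _ =
  HasCard-cong (λ s → mk⇔ proj₁ (λ p → p , InP⇒1≤ones s p , ones≤length s))
    (subst (HasCard _) (sym (sumS≡sum1to n n)) (HasCard-1≤∧≤ ones (HasCard-InP-ones n) n)) ,
  HasCard-InP-ones n
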